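{- For every positive integer $n$, the number of distinct $x$-ray lists (with zero entries omitted) arising from partitions of $n$ equals the number of partitions of $n$ into distinct parts.
   Context: For a partition $\lambda$ with $\ell(\lambda)$ parts, let $m=\max\{\lambda_1,\ell(\lambda)\}$ and let the Ferrers matrix of $\lambda$ be the $m\times m$ $0/1$ matrix whose $(i,j)$ entry is $1$ if $(i,j)$ is a cell of the Young diagram of $\lambda$ (i.e. $j\le\lambda_i$) and $0$ otherwise. The $x$-ray list $\lambda_x$ is the sequence $(s_2,s_3,\dots,s_{2m})$ where $s_k$ is the sum of the entries $(i,j)$ of the Ferrers matrix with $i+j=k$. Two $x$-ray lists are regarded as the same if they agree after deleting all zero entries. -}

module Defs where

open import Data.Nat using (ℕ; zero; suc; _+_; _*_; _∸_; _≤_; _<_; _≥_; _>_; _⊔_; _≟_; _≤?_)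
open import Data.Bool using (Bool; true; false; if_then_else_)
open import Data.Nat.ListAction using (sum)
open import Data.List using (List; []; _∷_; map; upTo; filter; length; concatMap)
open import Data.List.Relation.Unary.All using (All)
open import Data.List.Relation.Unary.Linked using (Linked)
open import Data.List.Relation.Unary.Unique.Propositional using (Unique)
open import Data.List.Membership.Propositional using (_∈_)
open import Data.Product using (Σ; _×_; ∃-syntax)
open import Relation.Nullary using (¬?)
open import Relation.Nullary.Decidable using (⌊_⌋; _×-dec_)
open import Relation.Binary.PropositionalEquality using (_≡_)

IsPartition : ℕ → List ℕ → Set
IsPartition n λs = All (λ p → p > 0) λs × Linked _≥_ λs × sum λs ≡ n

IsDistinctPartition : ℕ → List ℕ → Set
IsDistinctPartition n λs = All (λ p → p > 0) λs × Linked _>_ λs × sum λs ≡ n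

-- i-th part, 1-indexed; 0 beyond the length (and for i = 0).
part : List ℕ → ℕ → ℕ
part [] _ = 0
part (p ∷ ps) zero = 0
part (p ∷ ps) (suc zero) = p
part (p ∷ ps) (suc (suc i)) = part ps (suc i)

size : List ℕ → ℕ
size λs = part λs 1 ⊔ length λs

ferrers : List ℕ → ℕ → ℕ → ℕ
ferrers λs i j = if ⌊ (1 ≤? j) ×-dec (j ≤? part λs i) ⌋ then 1 else 0

range1 : ℕ → List ℕ
range1 m = map suc (upTo m)

antidiag : List ℕ → ℕ → ℕ
antidiag λs k = sum (concatMap (λ i → map (λ j →
  if ⌊ i + j ≟ k ⌋ then ferrers λs i j else 0) (range1 (size λs))) (range1 (size λs)))

xray : List ℕ → List ℕ
xray λs = map (antidiag λs) (map (2 +_) (upTo (2 * size λs ∸ 1)))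

xrayNZ : List ℕ → List ℕ
xrayNZ λs = filter (λ x → ¬? (x ≟ 0)) (xray λs)

IsXrayOf : ℕ → List ℕ → Set
IsXrayOf n x = ∃[ λs ] (IsPartition n λs × xrayNZ λs ≡ x)

-- Row r (counting from 0) of a Young diagram meets the antidiagonals r + 2, …, r + 1 + λ_{r+1} once
-- each, so the x-ray list is a sum of runs of ones, each run starting one place after the previous
-- one; for a partition this sum has no zeros before its end, so deleting zeros leaves exactly it.
-- Exchanging the tails of two consecutive rows, (a + 1, b) ↦ (b + 1, a), keeps both the sum of runs
-- and the size, and repeating it turns every partition into one with distinct parts and the same
-- x-ray list. On partitions into distinct parts the x-ray list is injective: its length is the first
-- part, and removing the first run leaves the x-ray list of the remaining parts.
module Submission where

open import Defs
open import Data.Bool using (if_then_else_; _∧_)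
open import Data.Bool.Properties using (if-eta)
open import Data.List using (List; []; _∷_; map; upTo; applyUpTo; concatMap; filter; foldr; _++_; replicate; length)
open import Data.List.Properties
  using (map-∘; map-upTo; filter-all; filter-none; filter-++; ++-identityʳ; length-replicate; length-map; ∷-injectiveˡ; ∷-injectiveʳ)
open import Data.List.Membership.Propositional using (_∈_)
import Data.List.Membership.Propositional.Properties as ∈
open import Data.List.Relation.Unary.All as All using (All; []; _∷_)
import Data.List.Relation.Unary.All.Properties as All
open import Data.List.Relation.Unary.AllPairs using ([]; _∷_)
open import Data.List.Relation.Unary.Any using (here)
open import Data.List.Relation.Unary.Linked as Linked using (Linked; []; [-]; _∷_)
open import Data.List.Relation.Unary.Unique.Propositional using (Unique)
import Data.List.Relation.Unary.Unique.Propositional.Properties as Unique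
open import Data.Nat using (ℕ; zero; suc; _+_; _*_; _∸_; _≤_; _<_; _≥_; _>_; _⊔_; _≡ᵇ_; _≤ᵇ_; z≤n; s≤s)
open import Data.Nat.ListAction using (sum)
open import Data.Nat.ListAction.Properties using (sum-++)
open import Data.Nat.Properties
open import Algebra.Properties.CommutativeSemigroup +-commutativeSemigroup using (x∙yz≈y∙xz)
open import Data.Product using (_×_; _,_; proj₂; ∃-syntax)
open import Data.Sum using (inj₁; inj₂)
open import Function.Bundles using (_⇔_; mk⇔; module Equivalence)
open import Relation.Nullary using (Dec; yes; no; ¬_; ¬?; contradiction)
open import Relation.Nullary.Decidable using (isYes; isYes≗does; _×-dec_)
open import Relation.Binary.PropositionalEquality

applyUpTo-cong : ∀ {f g : ℕ → ℕ} → (∀ i → f i ≡ g i) → ∀ n → applyUpTo f n ≡ applyUpTo g n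
applyUpTo-cong f≗g zero = refl
applyUpTo-cong f≗g (suc n) = cong₂ _∷_ (f≗g 0) (applyUpTo-cong (λ i → f≗g (suc i)) n)

sum-applyUpTo-zero : ∀ {f : ℕ → ℕ} → (∀ i → f i ≡ 0) → ∀ n → sum (applyUpTo f n) ≡ 0
sum-applyUpTo-zero f≗0 zero = refl
sum-applyUpTo-zero f≗0 (suc n) = cong₂ _+_ (f≗0 0) (sum-applyUpTo-zero (λ i → f≗0 (suc i)) n)

sum-concatMap : ∀ {A : Set} (f : A → List ℕ) xs → sum (concatMap f xs) ≡ sum (map (λ x → sum (f x)) xs)
sum-concatMap f [] = refl
sum-concatMap f (x ∷ xs) = trans (sum-++ (f x) (concatMap f xs)) (cong (sum (f x) +_) (sum-concatMap f xs))

map-range1 : ∀ (f : ℕ → ℕ) m → map f (range1 m) ≡ applyUpTo (λ j → f (suc j)) m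
map-range1 f m = trans (sym (map-∘ (upTo m))) (map-upTo (λ j → f (suc j)) m)

-- #{ j ∈ [1, b] ∣ i + j ≡ k }: the cells of a row of length b, placed as row i, on antidiagonal k.
rowOnAntidiag : ℕ → ℕ → ℕ → ℕ
rowOnAntidiag i k zero = 0
rowOnAntidiag i k (suc b) = (if suc i ≡ᵇ k then 1 else 0) + rowOnAntidiag (suc i) k b

rowOnAntidiag-suc : ∀ i k b → rowOnAntidiag (suc i) (suc k) b ≡ rowOnAntidiag i k b
rowOnAntidiag-suc i k zero = refl
rowOnAntidiag-suc i k (suc b) = cong (_ +_) (rowOnAntidiag-suc (suc i) k b)

rowOnAntidiag-zero : ∀ i b → rowOnAntidiag i 0 b ≡ 0
rowOnAntidiag-zero i zero = refl
rowOnAntidiag-zero i (suc b) = rowOnAntidiag-zero (suc i) b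

rowsOnAntidiag : List ℕ → ℕ → ℕ → ℕ
rowsOnAntidiag [] i k = 0
rowsOnAntidiag (p ∷ ps) i k = rowOnAntidiag i k p + rowsOnAntidiag ps (suc i) k

rowsOnAntidiag-suc : ∀ λs i k → rowsOnAntidiag λs (suc i) (suc k) ≡ rowsOnAntidiag λs i k
rowsOnAntidiag-suc [] i k = refl
rowsOnAntidiag-suc (p ∷ ps) i k = cong₂ _+_ (rowOnAntidiag-suc i k p) (rowsOnAntidiag-suc ps (suc i) k)

rowsOnAntidiag-zero : ∀ λs i → rowsOnAntidiag λs i 0 ≡ 0
rowsOnAntidiag-zero [] i = refl
rowsOnAntidiag-zero (p ∷ ps) i = cong₂ _+_ (rowOnAntidiag-zero i p) (rowsOnAntidiag-zero ps (suc i))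

module _ (k : ℕ) where

  cellOnAntidiag : ℕ → ℕ → ℕ → ℕ
  cellOnAntidiag i b j = if i + j ≡ᵇ k then (if (1 ≤ᵇ j) ∧ (j ≤ᵇ b) then 1 else 0) else 0

  sum-cellOnAntidiag : ∀ m i b → b ≤ m → sum (applyUpTo (λ j → cellOnAntidiag i b (suc j)) m) ≡ rowOnAntidiag i k b
  sum-cellOnAntidiag m i zero _ = sum-applyUpTo-zero (λ j → if-eta (i + suc j ≡ᵇ k)) m
  sum-cellOnAntidiag (suc m) i (suc b) (s≤s b≤m) = cong₂ _+_ first rest
    where
    first : cellOnAntidiag i (suc b) 1 ≡ (if suc i ≡ᵇ k then 1 else 0)
    first rewrite +-comm i 1 = refl
    shift : ∀ j → cellOnAntidiag i (suc b) (suc (suc j)) ≡ cellOnAntidiag (suc i) b (suc j)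
    shift j rewrite +-suc i (suc j) = refl
    rest = trans (cong sum (applyUpTo-cong shift m)) (sum-cellOnAntidiag m (suc i) b b≤m)

  sum-rowOnAntidiag : ∀ λs m i → length λs ≤ m →
    sum (applyUpTo (λ r → rowOnAntidiag (suc (i + r)) k (part λs (suc r))) m) ≡ rowsOnAntidiag λs (suc i) k
  sum-rowOnAntidiag [] m i _ = sum-applyUpTo-zero (λ _ → refl) m
  sum-rowOnAntidiag (p ∷ ps) (suc m) i (s≤s ℓ≤m) = cong₂ _+_ first rest
    where
    first : rowOnAntidiag (suc (i + 0)) k p ≡ rowOnAntidiag (suc i) k p
    first rewrite +-identityʳ i = refl
    shift : ∀ r → rowOnAntidiag (suc (i + suc r)) k (part (p ∷ ps) (suc (suc r))) ≡ rowOnAntidiag (suc (suc i + r)) k (part ps (suc r))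
    shift r rewrite +-suc i r = refl
    rest = trans (cong sum (applyUpTo-cong shift m)) (sum-rowOnAntidiag ps m (suc i) ℓ≤m)

antidiag≡rowsOnAntidiag : ∀ λs k → (∀ i → part λs i ≤ size λs) → antidiag λs k ≡ rowsOnAntidiag λs 1 k
antidiag≡rowsOnAntidiag λs k part≤size = begin
  antidiag λs k
    ≡⟨ sum-concatMap _ (range1 m) ⟩
  sum (map (λ i → sum (map (entry i) (range1 m))) (range1 m))
    ≡⟨ cong sum (map-range1 _ m) ⟩
  sum (applyUpTo (λ i → sum (map (entry (suc i)) (range1 m))) m)
    ≡⟨ cong sum (applyUpTo-cong row m) ⟩
  sum (applyUpTo (λ i → rowOnAntidiag (suc i) k (part λs (suc i))) m)
    ≡⟨ sum-rowOnAntidiag k λs m 0 (m≤n⊔m (part λs 1) (length λs)) ⟩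
  rowsOnAntidiag λs 1 k ∎
  where
  open ≡-Reasoning
  m = size λs
  entry : ℕ → ℕ → ℕ
  entry i j = if isYes (i + j ≟ k) then ferrers λs i j else 0
  entry≡cellOnAntidiag : ∀ i j → entry i j ≡ cellOnAntidiag k i (part λs i) j
  entry≡cellOnAntidiag i j rewrite isYes≗does (i + j ≟ k) | isYes≗does ((1 ≤? j) ×-dec (j ≤? part λs i)) = refl
  row : ∀ i → sum (map (entry (suc i)) (range1 m)) ≡ rowOnAntidiag (suc i) k (part λs (suc i))
  row i = trans (cong sum (trans (map-range1 _ m) (applyUpTo-cong (λ j → entry≡cellOnAntidiag (suc i) (suc j)) m)))
                (sum-cellOnAntidiag k m (suc i) (part λs (suc i)) (part≤size (suc i)))

infixl 6 _⊕_

_⊕_ : List ℕ → List ℕ → List ℕ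
[] ⊕ ys = ys
(x ∷ xs) ⊕ [] = x ∷ xs
(x ∷ xs) ⊕ (y ∷ ys) = x + y ∷ xs ⊕ ys

nth : List ℕ → ℕ → ℕ
nth [] _ = 0
nth (x ∷ xs) zero = x
nth (x ∷ xs) (suc t) = nth xs t

Positive : List ℕ → Set
Positive = All (0 <_)

⊕-identityʳ : ∀ xs → xs ⊕ [] ≡ xs
⊕-identityʳ [] = refl
⊕-identityʳ (x ∷ xs) = refl

⊕-comm : ∀ xs ys → xs ⊕ ys ≡ ys ⊕ xs
⊕-comm [] [] = refl
⊕-comm [] (y ∷ ys) = refl
⊕-comm (x ∷ xs) [] = refl
⊕-comm (x ∷ xs) (y ∷ ys) = cong₂ _∷_ (+-comm x y) (⊕-comm xs ys)

⊕-assoc : ∀ xs ys zs → (xs ⊕ ys) ⊕ zs ≡ xs ⊕ (ys ⊕ zs)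
⊕-assoc [] ys zs = refl
⊕-assoc (x ∷ xs) [] zs = refl
⊕-assoc (x ∷ xs) (y ∷ ys) [] = refl
⊕-assoc (x ∷ xs) (y ∷ ys) (z ∷ zs) = cong₂ _∷_ (+-assoc x y z) (⊕-assoc xs ys zs)

nth-⊕ : ∀ xs ys t → nth (xs ⊕ ys) t ≡ nth xs t + nth ys t
nth-⊕ [] ys t = refl
nth-⊕ (x ∷ xs) [] zero = sym (+-identityʳ x)
nth-⊕ (x ∷ xs) [] (suc t) = sym (+-identityʳ (nth xs t))
nth-⊕ (x ∷ xs) (y ∷ ys) zero = refl
nth-⊕ (x ∷ xs) (y ∷ ys) (suc t) = nth-⊕ xs ys t

length-⊕ : ∀ xs ys → length (xs ⊕ ys) ≡ length xs ⊔ length ys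
length-⊕ [] ys = refl
length-⊕ (x ∷ xs) [] = refl
length-⊕ (x ∷ xs) (y ∷ ys) = cong suc (length-⊕ xs ys)

⊕-positive : ∀ {xs ys} → Positive xs → Positive ys → Positive (xs ⊕ ys)
⊕-positive [] ys⁺ = ys⁺
⊕-positive (x⁺ ∷ xs⁺) [] = x⁺ ∷ xs⁺
⊕-positive {x ∷ _} (x⁺ ∷ xs⁺) (y⁺ ∷ ys⁺) = ≤-trans x⁺ (m≤m+n x _) ∷ ⊕-positive xs⁺ ys⁺

⊕-cancelˡ : ∀ xs {ys zs} → Positive ys → Positive zs → xs ⊕ ys ≡ xs ⊕ zs → ys ≡ zs
⊕-cancelˡ [] _ _ eq = eq
⊕-cancelˡ (x ∷ xs) {[]} {[]} _ _ _ = refl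
⊕-cancelˡ (x ∷ xs) {[]} {z ∷ zs} _ (z⁺ ∷ _) eq = contradiction (∷-injectiveˡ eq) (<⇒≢ (m<m+n x z⁺))
⊕-cancelˡ (x ∷ xs) {y ∷ ys} {[]} (y⁺ ∷ _) _ eq = contradiction (∷-injectiveˡ (sym eq)) (<⇒≢ (m<m+n x y⁺))
⊕-cancelˡ (x ∷ xs) {y ∷ ys} {z ∷ zs} (_ ∷ ys⁺) (_ ∷ zs⁺) eq =
  cong₂ _∷_ (+-cancelˡ-≡ x y z (∷-injectiveˡ eq)) (⊕-cancelˡ xs ys⁺ zs⁺ (∷-injectiveʳ eq))

xrayRows : List ℕ → List ℕ
xrayRows [] = []
xrayRows (p ∷ ps) = replicate p 1 ⊕ (0 ∷ xrayRows ps)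

rowOnAntidiag-replicate : ∀ t b → rowOnAntidiag 0 (suc t) b ≡ nth (replicate b 1) t
rowOnAntidiag-replicate t zero = refl
rowOnAntidiag-replicate zero (suc b) = cong suc (trans (rowOnAntidiag-suc 0 0 b) (rowOnAntidiag-zero 0 b))
rowOnAntidiag-replicate (suc t) (suc b) = trans (rowOnAntidiag-suc 0 (suc t) b) (rowOnAntidiag-replicate t b)

nth-xrayRows : ∀ λs t → nth (xrayRows λs) t ≡ rowsOnAntidiag λs 0 (suc t)
nth-xrayRows [] t = refl
nth-xrayRows (p ∷ ps) t =
  trans (nth-⊕ (replicate p 1) (0 ∷ xrayRows ps) t) (cong₂ _+_ (sym (rowOnAntidiag-replicate t p)) (nth-tail t))
  where
  nth-tail : ∀ t → nth (0 ∷ xrayRows ps) t ≡ rowsOnAntidiag ps 1 (suc t)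
  nth-tail zero = sym (trans (rowsOnAntidiag-suc ps 0 0) (rowsOnAntidiag-zero ps 0))
  nth-tail (suc t) = trans (nth-xrayRows ps t) (sym (rowsOnAntidiag-suc ps 0 (suc t)))

applyUpTo-nth : ∀ xs n → length xs ≤ n → applyUpTo (nth xs) n ≡ xs ++ replicate (n ∸ length xs) 0
applyUpTo-nth [] zero _ = refl
applyUpTo-nth [] (suc n) _ = cong (0 ∷_) (applyUpTo-nth [] n z≤n)
applyUpTo-nth (x ∷ xs) (suc n) (s≤s ℓ≤n) = cong (x ∷_) (applyUpTo-nth xs n ℓ≤n)

xrayRows-positive : ∀ {λs} → Positive λs → Positive (xrayRows λs)
xrayRows-positive [] = []
xrayRows-positive {suc p ∷ ps} (_ ∷ ps⁺) = s≤s z≤n ∷ ⊕-positive (replicate-positive p) (xrayRows-positive ps⁺)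
  where
  replicate-positive : ∀ n → Positive (replicate n 1)
  replicate-positive zero = []
  replicate-positive (suc n) = s≤s z≤n ∷ replicate-positive n

length-xrayRows-∷ : ∀ p ps → length (xrayRows (p ∷ ps)) ≡ p ⊔ suc (length (xrayRows ps))
length-xrayRows-∷ p ps = trans (length-⊕ (replicate p 1) (0 ∷ xrayRows ps)) (cong (_⊔ _) (length-replicate p))

length-xrayRows-∷≤ : ∀ {p ps} → Positive (p ∷ ps) → Linked _≥_ (p ∷ ps) → length (xrayRows (p ∷ ps)) ≤ p + length ps
length-xrayRows-∷≤ {p} {[]} (p⁺ ∷ _) _ rewrite length-xrayRows-∷ p [] | +-identityʳ p = ⊔-lub ≤-refl p⁺
length-xrayRows-∷≤ {p} {q ∷ qs} (_ ∷ ps⁺) (q≤p ∷ ps↓) rewrite length-xrayRows-∷ p (q ∷ qs) =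
  ⊔-lub (m≤m+n p _) (begin
    suc (length (xrayRows (q ∷ qs))) ≤⟨ s≤s (length-xrayRows-∷≤ ps⁺ ps↓) ⟩
    suc (q + length qs)              ≤⟨ s≤s (+-monoˡ-≤ (length qs) q≤p) ⟩
    suc (p + length qs)              ≡⟨ sym (+-suc p (length qs)) ⟩
    p + suc (length qs)              ∎)
  where open ≤-Reasoning

+≤2*⊔suc∸1 : ∀ m n → m + n ≤ 2 * (m ⊔ suc n) ∸ 1
+≤2*⊔suc∸1 m n = begin
  m + n                 ≡⟨ cong (_∸ 1) (sym (+-suc m n)) ⟩
  (m + suc n) ∸ 1       ≤⟨ ∸-monoˡ-≤ 1 (+-mono-≤ (m≤m⊔n m (suc n)) (m≤n⊔m m (suc n))) ⟩
  (M + M) ∸ 1           ≡⟨ cong (λ k → (M + k) ∸ 1) (sym (+-identityʳ M)) ⟩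
  2 * M ∸ 1             ∎
  where
  open ≤-Reasoning
  M = m ⊔ suc n

length-xrayRows≤2*size∸1 : ∀ {λs} → Positive λs → Linked _≥_ λs → length (xrayRows λs) ≤ 2 * size λs ∸ 1
length-xrayRows≤2*size∸1 [] _ = z≤n
length-xrayRows≤2*size∸1 {p ∷ ps} λs⁺ λs↓ = ≤-trans (length-xrayRows-∷≤ λs⁺ λs↓) (+≤2*⊔suc∸1 p (length ps))

part≤part₁ : ∀ {λs} → Linked _≥_ λs → ∀ i → part λs i ≤ part λs 1
part≤part₁ [] i = z≤n
part≤part₁ [-] zero = z≤n
part≤part₁ [-] (suc zero) = ≤-refl
part≤part₁ [-] (suc (suc i)) = z≤n
part≤part₁ (_ ∷ _) zero = z≤n
part≤part₁ (_ ∷ _) (suc zero) = ≤-refl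
part≤part₁ (q≤p ∷ ps↓) (suc (suc i)) = ≤-trans (part≤part₁ ps↓ (suc i)) q≤p

xray≡xrayRows++zeros : ∀ {λs} → Positive λs → Linked _≥_ λs →
  xray λs ≡ xrayRows λs ++ replicate (2 * size λs ∸ 1 ∸ length (xrayRows λs)) 0
xray≡xrayRows++zeros {λs} λs⁺ λs↓ = begin
  map (antidiag λs) (map (2 +_) (upTo N)) ≡⟨ sym (map-∘ (upTo N)) ⟩
  map (λ t → antidiag λs (2 + t)) (upTo N) ≡⟨ map-upTo _ N ⟩
  applyUpTo (λ t → antidiag λs (2 + t)) N ≡⟨ applyUpTo-cong entry N ⟩
  applyUpTo (nth (xrayRows λs)) N         ≡⟨ applyUpTo-nth (xrayRows λs) N (length-xrayRows≤2*size∸1 λs⁺ λs↓) ⟩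
  xrayRows λs ++ replicate (N ∸ length (xrayRows λs)) 0 ∎
  where
  open ≡-Reasoning
  N = 2 * size λs ∸ 1
  part≤size : ∀ i → part λs i ≤ size λs
  part≤size i = ≤-trans (part≤part₁ λs↓ i) (m≤m⊔n (part λs 1) (length λs))
  entry : ∀ t → antidiag λs (2 + t) ≡ nth (xrayRows λs) t
  entry t = begin
    antidiag λs (2 + t)              ≡⟨ antidiag≡rowsOnAntidiag λs (2 + t) part≤size ⟩
    rowsOnAntidiag λs 1 (2 + t)      ≡⟨ rowsOnAntidiag-suc λs 0 (suc t) ⟩
    rowsOnAntidiag λs 0 (suc t)      ≡⟨ sym (nth-xrayRows λs t) ⟩
    nth (xrayRows λs) t              ∎

xrayNZ≡xrayRows : ∀ {λs} → Positive λs → Linked _≥_ λs → xrayNZ λs ≡ xrayRows λs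
xrayNZ≡xrayRows {λs} λs⁺ λs↓ = begin
  filter nonzero? (xray λs)                                  ≡⟨ cong (filter nonzero?) (xray≡xrayRows++zeros λs⁺ λs↓) ⟩
  filter nonzero? (xrayRows λs ++ replicate z 0)             ≡⟨ filter-++ nonzero? (xrayRows λs) (replicate z 0) ⟩
  filter nonzero? (xrayRows λs) ++ filter nonzero? (replicate z 0)
    ≡⟨ cong₂ _++_ (filter-all nonzero? (All.map >⇒≢ (xrayRows-positive λs⁺))) (filter-none nonzero? (zeros z)) ⟩
  xrayRows λs ++ []                                           ≡⟨ ++-identityʳ (xrayRows λs) ⟩
  xrayRows λs ∎
  where
  open ≡-Reasoning
  nonzero? = λ (x : ℕ) → ¬? (x ≟ 0)
  z = 2 * size λs ∸ 1 ∸ length (xrayRows λs)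
  zeros : ∀ n → All (λ x → ¬ ¬ x ≡ 0) (replicate n 0)
  zeros zero = []
  zeros (suc n) = (λ x≢0 → x≢0 refl) ∷ zeros n

xrayRows-swap : ∀ a b ps → xrayRows (suc a ∷ b ∷ ps) ≡ xrayRows (suc b ∷ a ∷ ps)
xrayRows-swap a b ps = cong (1 ∷_) (begin
  A ⊕ (B ⊕ Z) ≡⟨ sym (⊕-assoc A B Z) ⟩
  (A ⊕ B) ⊕ Z ≡⟨ cong (_⊕ Z) (⊕-comm A B) ⟩
  (B ⊕ A) ⊕ Z ≡⟨ ⊕-assoc B A Z ⟩
  B ⊕ (A ⊕ Z) ∎)
  where
  open ≡-Reasoning
  A = replicate a 1
  B = replicate b 1
  Z = 0 ∷ xrayRows ps

length≤part₁ : ∀ {μ} → Positive μ → Linked _>_ μ → length μ ≤ part μ 1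
length≤part₁ [] _ = z≤n
length≤part₁ (p⁺ ∷ _) [-] = p⁺
length≤part₁ (_ ∷ μ⁺) (q<p ∷ μ↓) = ≤-trans (s≤s (length≤part₁ μ⁺ μ↓)) q<p

length-xrayRows-distinct : ∀ {μ} → Positive μ → Linked _>_ μ → length (xrayRows μ) ≡ part μ 1
length-xrayRows-distinct [] _ = refl
length-xrayRows-distinct {p ∷ []} (p⁺ ∷ _) _ = trans (length-xrayRows-∷ p []) (m≥n⇒m⊔n≡m p⁺)
length-xrayRows-distinct {p ∷ q ∷ qs} (_ ∷ μ⁺) (q<p ∷ μ↓) =
  trans (length-xrayRows-∷ p (q ∷ qs)) (trans (cong (λ l → p ⊔ suc l) (length-xrayRows-distinct μ⁺ μ↓)) (m≥n⇒m⊔n≡m q<p))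

xrayRows-injective : ∀ {μ ν} → Positive μ → Linked _>_ μ → Positive ν → Linked _>_ ν →
  xrayRows μ ≡ xrayRows ν → μ ≡ ν
xrayRows-injective μ⁺ μ↓ ν⁺ ν↓ eq with
  trans (sym (length-xrayRows-distinct μ⁺ μ↓)) (trans (cong length eq) (length-xrayRows-distinct ν⁺ ν↓))
xrayRows-injective {[]} {[]} _ _ _ _ _ | _ = refl
xrayRows-injective {[]} {q ∷ _} _ _ (q⁺ ∷ _) _ _ | 0≡q = contradiction 0≡q (<⇒≢ q⁺)
xrayRows-injective {p ∷ _} {[]} (p⁺ ∷ _) _ _ _ _ | p≡0 = contradiction (sym p≡0) (<⇒≢ p⁺)
xrayRows-injective {suc p ∷ ps} {suc p ∷ qs} (_ ∷ ps⁺) μ↓ (_ ∷ qs⁺) ν↓ eq | refl =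
  cong (suc p ∷_) (xrayRows-injective ps⁺ (Linked.tail μ↓) qs⁺ (Linked.tail ν↓)
    (⊕-cancelˡ (replicate p 1) (xrayRows-positive ps⁺) (xrayRows-positive qs⁺) (∷-injectiveʳ eq)))

-- Inserting a part p ≥ length ν into a strict partition ν: p goes in front if it exceeds the first
-- part q; otherwise the rows (p, q) are exchanged for (q + 1, p − 1) (see xrayRows-swap) and p − 1 is
-- inserted further down, a zero part being dropped.
insert : ℕ → List ℕ → List ℕ
insert zero ν = ν
insert (suc p) [] = suc p ∷ []
insert (suc p) (q ∷ ν) with q ≤? p
... | yes _ = suc p ∷ q ∷ ν
... | no _ = suc q ∷ insert p ν

sum-insert : ∀ p ν → sum (insert p ν) ≡ p + sum ν
sum-insert zero ν = refl
sum-insert (suc p) [] = refl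
sum-insert (suc p) (q ∷ ν) with q ≤? p
... | yes _ = refl
... | no _ = cong suc (trans (cong (q +_) (sum-insert p ν)) (x∙yz≈y∙xz q p (sum ν)))

insert-positive : ∀ p {ν} → Positive ν → Positive (insert p ν)
insert-positive zero ν⁺ = ν⁺
insert-positive (suc p) [] = s≤s z≤n ∷ []
insert-positive (suc p) {q ∷ ν} (q⁺ ∷ ν⁺) with q ≤? p
... | yes _ = s≤s z≤n ∷ q⁺ ∷ ν⁺
... | no _ = s≤s z≤n ∷ insert-positive p ν⁺

part₁-insert≤ : ∀ p ν → part (insert p ν) 1 ≤ p ⊔ suc (part ν 1)
part₁-insert≤ zero [] = z≤n
part₁-insert≤ zero (q ∷ ν) = n≤1+n q
part₁-insert≤ (suc p) [] = m≤m⊔n (suc p) 1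
part₁-insert≤ (suc p) (q ∷ ν) with q ≤? p
... | yes _ = m≤m⊔n (suc p) (suc q)
... | no _ = m≤n⊔m (suc p) (suc q)

∷-decreasing : ∀ {x xs} → part xs 1 < x → Linked _>_ xs → Linked _>_ (x ∷ xs)
∷-decreasing {xs = []} _ _ = [-]
∷-decreasing {xs = _ ∷ _} y<x xs↓ = y<x ∷ xs↓

insert-decreasing : ∀ p {ν} → Linked _>_ ν → Linked _>_ (insert p ν)
insert-decreasing zero ν↓ = ν↓
insert-decreasing (suc p) [] = [-]
insert-decreasing (suc p) {q ∷ ν} qν↓ with q ≤? p
... | yes q≤p = s≤s q≤p ∷ qν↓
... | no q≰p = ∷-decreasing (s≤s (≤-trans (part₁-insert≤ p ν) (⊔-lub p≤q (part₁-tail< qν↓))))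
                           (insert-decreasing p (Linked.tail qν↓))
  where
  p≤q : p ≤ q
  p≤q = <⇒≤ (≰⇒> q≰p)
  part₁-tail< : ∀ {ν} → Linked _>_ (q ∷ ν) → part ν 1 < q
  part₁-tail< [-] = ≤-<-trans z≤n (≰⇒> q≰p)
  part₁-tail< (r<q ∷ _) = r<q

length-insert≤ : ∀ p {ν} → Positive ν → Linked _>_ ν → length ν ≤ p → length (insert p ν) ≤ p
length-insert≤ zero _ _ ℓ≤0 = ℓ≤0
length-insert≤ (suc p) {[]} _ _ _ = s≤s z≤n
length-insert≤ (suc p) {q ∷ ν} ν⁺ ν↓ (s≤s ℓ≤p) with q ≤? p
... | yes q≤p = s≤s (≤-trans (length≤part₁ ν⁺ ν↓) q≤p)
... | no _ = s≤s (length-insert≤ p (All.tail ν⁺) (Linked.tail ν↓) ℓ≤p)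

xrayRows-insert : ∀ p {ν} → 0 < p → Positive ν → length ν ≤ p → xrayRows (insert p ν) ≡ xrayRows (p ∷ ν)
xrayRows-insert (suc p) {[]} _ _ _ = refl
-- For p = 1 the exchanged rows are (q + 1, 0), and a trailing empty row does not change the x-ray.
xrayRows-insert (suc zero) {q ∷ []} _ (q⁺ ∷ _) _ with q ≤? 0 | q⁺
... | yes _ | _ = refl
... | no _ | s≤s {n = q′} _ = cong (λ t → 1 ∷ 1 ∷ t) (sym (⊕-identityʳ (replicate q′ 1)))
xrayRows-insert (suc zero) {_ ∷ _ ∷ _} _ _ (s≤s ())
xrayRows-insert (suc (suc p)) {q ∷ ν} _ (_ ∷ ν⁺) (s≤s ℓ≤p) with q ≤? suc p
... | yes _ = refl
... | no _ = begin
  xrayRows (suc q ∷ insert (suc p) ν) ≡⟨ cong (λ t → replicate (suc q) 1 ⊕ (0 ∷ t)) (xrayRows-insert (suc p) (s≤s z≤n) ν⁺ ℓ≤p) ⟩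
  xrayRows (suc q ∷ suc p ∷ ν)        ≡⟨ xrayRows-swap q (suc p) ν ⟩
  xrayRows (suc (suc p) ∷ q ∷ ν)      ∎
  where open ≡-Reasoning

strict : List ℕ → List ℕ
strict = foldr insert []

sum-strict : ∀ λs → sum (strict λs) ≡ sum λs
sum-strict [] = refl
sum-strict (p ∷ ps) = trans (sum-insert p (strict ps)) (cong (p +_) (sum-strict ps))

strict-positive : ∀ λs → Positive (strict λs)
strict-positive [] = []
strict-positive (p ∷ ps) = insert-positive p (strict-positive ps)

strict-decreasing : ∀ λs → Linked _>_ (strict λs)
strict-decreasing [] = []
strict-decreasing (p ∷ ps) = insert-decreasing p (strict-decreasing ps)

length-strict-tail≤ : ∀ {p ps} → Linked _≥_ (p ∷ ps) → length (strict ps) ≤ p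
length-strict-tail≤ {ps = []} _ = z≤n
length-strict-tail≤ {ps = q ∷ qs} (q≤p ∷ qs↓) =
  ≤-trans (length-insert≤ q (strict-positive qs) (strict-decreasing qs) (length-strict-tail≤ qs↓)) q≤p

xrayRows-strict : ∀ {λs} → Positive λs → Linked _≥_ λs → xrayRows (strict λs) ≡ xrayRows λs
xrayRows-strict {[]} _ _ = refl
xrayRows-strict {p ∷ ps} (p⁺ ∷ ps⁺) λs↓ = begin
  xrayRows (insert p (strict ps)) ≡⟨ xrayRows-insert p p⁺ (strict-positive ps) (length-strict-tail≤ λs↓) ⟩
  xrayRows (p ∷ strict ps)        ≡⟨ cong (λ t → replicate p 1 ⊕ (0 ∷ t)) (xrayRows-strict ps⁺ (Linked.tail λs↓)) ⟩
  xrayRows (p ∷ ps)               ∎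
  where open ≡-Reasoning

decreasingLists : ℕ → List (List ℕ)
decreasingLists zero = [] ∷ []
decreasingLists (suc k) = decreasingLists k ++ map (suc k ∷_) (decreasingLists k)

part₁≤-decreasingLists : ∀ k {d} → d ∈ decreasingLists k → part d 1 ≤ k
part₁≤-decreasingLists zero (here refl) = z≤n
part₁≤-decreasingLists (suc k) d∈ with ∈.∈-++⁻ (decreasingLists k) d∈
... | inj₁ d∈ₖ = ≤-trans (part₁≤-decreasingLists k d∈ₖ) (n≤1+n k)
... | inj₂ d∈ₖ with ∈.∈-map⁻ (suc k ∷_) d∈ₖ
... | _ , _ , refl = ≤-refl

decreasingLists-unique : ∀ k → Unique (decreasingLists k)
decreasingLists-unique zero = [] ∷ []
decreasingLists-unique (suc k) =
  Unique.++⁺ (decreasingLists-unique k) (Unique.map⁺ ∷-injectiveʳ (decreasingLists-unique k)) disjoint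
  where
  disjoint : ∀ {d} → ¬ (d ∈ decreasingLists k × d ∈ map (suc k ∷_) (decreasingLists k))
  disjoint (d∈ , d∈′) with ∈.∈-map⁻ (suc k ∷_) d∈′
  ... | _ , _ , refl = <-irrefl refl (part₁≤-decreasingLists k d∈)

∈-decreasingLists : ∀ k {d} → Positive d → Linked _>_ d → part d 1 ≤ k → d ∈ decreasingLists k
∈-decreasingLists zero {[]} _ _ _ = here refl
∈-decreasingLists zero {p ∷ _} (p⁺ ∷ _) _ p≤0 = contradiction p≤0 (<⇒≱ p⁺)
∈-decreasingLists (suc k) {d} d⁺ d↓ d≤1+k with part d 1 ≤? k
... | yes d≤k = ∈.∈-++⁺ˡ (∈-decreasingLists k d⁺ d↓ d≤k)
∈-decreasingLists (suc k) {[]} _ _ _ | no 0≰k = contradiction z≤n 0≰k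
∈-decreasingLists (suc k) {p ∷ d} (_ ∷ d⁺) pd↓ p≤1+k | no p≰k with ≤-antisym p≤1+k (≰⇒> p≰k)
... | refl = ∈.∈-++⁺ʳ (decreasingLists k) (∈.∈-map⁺ (suc k ∷_) (∈-decreasingLists k d⁺ (Linked.tail pd↓) (part₂≤k pd↓)))
  where
  part₂≤k : Linked _>_ (suc k ∷ d) → part d 1 ≤ k
  part₂≤k [-] = z≤n
  part₂≤k (s≤s q≤k ∷ _) = q≤k

isDistinctPartition? : ∀ n d → Dec (IsDistinctPartition n d)
isDistinctPartition? n d = All.all? (0 <?_) d ×-dec Linked.linked? _>?_ d ×-dec (sum d ≟ n)

distinctPartitions : ℕ → List (List ℕ)
distinctPartitions n = filter (isDistinctPartition? n) (decreasingLists n)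

distinctPartitions-unique : ∀ n → Unique (distinctPartitions n)
distinctPartitions-unique n = Unique.filter⁺ (isDistinctPartition? n) (decreasingLists-unique n)

∈-distinctPartitions⇔ : ∀ n d → d ∈ distinctPartitions n ⇔ IsDistinctPartition n d
∈-distinctPartitions⇔ n d = mk⇔ (λ d∈ → proj₂ (∈.∈-filter⁻ (isDistinctPartition? n) {xs = decreasingLists n} d∈)) from
  where
  part₁≤sum : ∀ d → part d 1 ≤ sum d
  part₁≤sum [] = z≤n
  part₁≤sum (p ∷ d) = m≤m+n p (sum d)
  from : IsDistinctPartition n d → d ∈ distinctPartitions n
  from d∈D@(d⁺ , d↓ , refl) = ∈.∈-filter⁺ (isDistinctPartition? n) (∈-decreasingLists n d⁺ d↓ (part₁≤sum d)) d∈D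

distinct⇒partition : ∀ {n d} → IsDistinctPartition n d → IsPartition n d
distinct⇒partition (d⁺ , d↓ , Σd) = d⁺ , Linked.map <⇒≤ d↓ , Σd

strict-distinct : ∀ {n λs} → IsPartition n λs → IsDistinctPartition n (strict λs)
strict-distinct {λs = λs} (_ , _ , Σλ) = strict-positive λs , strict-decreasing λs , trans (sum-strict λs) Σλ

xrayNZ-strict : ∀ {n λs} → IsPartition n λs → xrayNZ (strict λs) ≡ xrayNZ λs
xrayNZ-strict {λs = λs} λ∈P@(λs⁺ , λs↓ , _) = begin
  xrayNZ (strict λs)   ≡⟨ xrayNZ≡xrayRows μ⁺ (Linked.map <⇒≤ μ↓) ⟩
  xrayRows (strict λs) ≡⟨ xrayRows-strict λs⁺ λs↓ ⟩
  xrayRows λs          ≡⟨ sym (xrayNZ≡xrayRows λs⁺ λs↓) ⟩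
  xrayNZ λs            ∎
  where
  open ≡-Reasoning
  μ⁺ = strict-positive λs
  μ↓ = strict-decreasing λs

xrayNZ-injective : ∀ {m n μ ν} → IsDistinctPartition m μ → IsDistinctPartition n ν → xrayNZ μ ≡ xrayNZ ν → μ ≡ ν
xrayNZ-injective {μ = μ} {ν} (μ⁺ , μ↓ , _) (ν⁺ , ν↓ , _) eq = xrayRows-injective μ⁺ μ↓ ν⁺ ν↓ (begin
  xrayRows μ ≡⟨ sym (xrayNZ≡xrayRows μ⁺ (Linked.map <⇒≤ μ↓)) ⟩
  xrayNZ μ   ≡⟨ eq ⟩
  xrayNZ ν   ≡⟨ xrayNZ≡xrayRows ν⁺ (Linked.map <⇒≤ ν↓) ⟩
  xrayRows ν ∎)
  where open ≡-Reasoning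

unique-map : ∀ {A B : Set} {P : A → Set} {f : A → B} → (∀ {x y} → P x → P y → f x ≡ f y → x ≡ y) →
  ∀ {xs} → All P xs → Unique xs → Unique (map f xs)
unique-map inj [] [] = []
unique-map inj (px ∷ pxs) (x∉ ∷ xs!) =
  All.map⁺ (All.zipWith (λ (x≢y , py) fx≡fy → x≢y (inj px py fx≡fy)) (x∉ , pxs)) ∷ unique-map inj pxs xs!

xrays : ℕ → List (List ℕ)
xrays n = map xrayNZ (distinctPartitions n)

xrays-unique : ∀ n → Unique (xrays n)
xrays-unique n = unique-map xrayNZ-injective
  (All.tabulate (Equivalence.to (∈-distinctPartitions⇔ n _))) (distinctPartitions-unique n)

∈-xrays⇔ : ∀ n x → x ∈ xrays n ⇔ IsXrayOf n x
∈-xrays⇔ n x = mk⇔ to from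
  where
  to : x ∈ xrays n → IsXrayOf n x
  to x∈ with ∈.∈-map⁻ xrayNZ x∈
  ... | d , d∈ , refl = d , distinct⇒partition (Equivalence.to (∈-distinctPartitions⇔ n d) d∈) , refl
  from : IsXrayOf n x → x ∈ xrays n
  from (λs , λ∈P , refl) = subst (_∈ xrays n) (xrayNZ-strict λ∈P)
    (∈.∈-map⁺ xrayNZ (Equivalence.from (∈-distinctPartitions⇔ n (strict λs)) (strict-distinct λ∈P)))

theorem6p4 : (n : ℕ) → 1 Data.Nat.≤ n →
    ∃[ X ] ∃[ D ]
    (Unique X × (∀ x → (x ∈ X) ⇔ IsXrayOf n x)
    × Unique D × (∀ d → (d ∈ D) ⇔ IsDistinctPartition n d)
    × length X ≡ length D)
theorem6p4 n _ =
  xrays n , distinctPartitions n ,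
  xrays-unique n , ∈-xrays⇔ n ,
  distinctPartitions-unique n , ∈-distinctPartitions⇔ n ,
  length-map xrayNZ (distinctPartitions n)
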